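{- Let $B>1$ and $N>1$ be integers with $\gcd(N,B)=1$, let $e=\operatorname{ord}(B,N)$, and suppose $N\in M_2(B)$ (in particular $e$ is even). Then for every even divisor $d$ of $e$ we have $N\in M_d(B)$, and for every $x$ with $1\le x<N$, $\gcd(x,N)=1$, the multiplier satisfies $m_d(x)=d/2$, i.e. $S_d(x)=\tfrac d2\,(B^{e/d}-1)$.
   Context: $\operatorname{ord}(B,N)$ is the least positive integer $e$ with $B^e\equiv1\pmod N$. For a divisor $d$ of $e$ put $k=e/d$. For $x$ with $1\le x<N$, $\gcd(x,N)=1$, let $x/N=0.a_1a_2\ldots$ be its base-$B$ expansion (purely periodic with period $a_1\ldots a_e$), and let $S_d(x)=\sum_{j=1}^d\sum_{i=1}^k a_{(j-1)k+i}B^{k-i}$ be the sum of the integers represented in base $B$ by the $d$ consecutive blocks of length $k$ of the period. We say $N\in M_d(B)$ if $d\mid e$ and $S_d(x)\equiv0\pmod{B^k-1}$ for every such $x$. When $N\in M_d(B)$, the multiplier is the integer $m_d(x)=S_d(x)/(B^k-1)$. -}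

module Defs where

open import Data.Nat using (ℕ; zero; suc; _+_; _*_; _∸_; _^_; _≤_; _<_; _/_; _%_)
open import Data.Nat.Divisibility using (_∣_)
open import Data.Nat.Coprimality using (Coprime)
open import Data.Product using (Σ; _×_)
open import Relation.Binary.PropositionalEquality using (_≡_)

-- Total versions of ⌊m/n⌋ and m mod n (value at n = 0 is an irrelevant convention;
-- they are only used with n = N > 1 and n = B > 1).
_div′_ : ℕ → ℕ → ℕ
m div′ zero = 0
m div′ suc n = m / suc n

_mod′_ : ℕ → ℕ → ℕ
m mod′ zero = m
m mod′ suc n = m % suc n

sumTo : ℕ → (ℕ → ℕ) → ℕ
sumTo zero f = 0
sumTo (suc n) f = sumTo n f + f n

IsOrd : ℕ → ℕ → ℕ → Set
IsOrd B N e = (0 < e × N ∣ (B ^ e ∸ 1)) × (∀ f → 0 < f → N ∣ (B ^ f ∸ 1) → e ≤ f)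

-- i-th base-B digit (i ≥ 1) of x/N = 0.a₁a₂…:  a_i = ⌊B^i x / N⌋ mod B
digit : (B N x i : ℕ) → ℕ
digit B N x i = ((B ^ i * x) div′ N) mod′ B

-- S_d(x) with block length k: Σ_{j=1}^{d} Σ_{i=1}^{k} a_{(j-1)k+i} B^{k-i}
-- (written 0-indexed: j' = j-1 < d, i' = i-1 < k)
S : (B N d k x : ℕ) → ℕ
S B N d k x = sumTo d (λ j → sumTo k (λ i → digit B N x (j * k + i + 1) * B ^ (k ∸ 1 ∸ i)))

Unit : ℕ → ℕ → Set
Unit N x = 1 ≤ x × x < N × Coprime x N

-- N ∈ M_d(B), where e = ord(B,N): d ∣ e (with k = e/d) and
-- S_d(x) ≡ 0 (mod B^k - 1) for every unit x
InM : (d B N e : ℕ) → Set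
InM d B N e = Σ ℕ (λ k → e ≡ k * d × (∀ x → Unit N x → (B ^ k ∸ 1) ∣ S B N d k x))

{-# OPTIONS --safe #-}
-- Let r t = B ^ t * x mod N be the remainders of the long division of x by N in base B, so that
-- N a_(t+1) + r_(t+1) = B r_t.  A block of k digits following position s therefore satisfies
-- N * block + r_(s+k) = B^k r_s, and summing over the d blocks of one period, which returns to
-- r_0, gives  N S_d(x) = (B^k - 1) Σ_j r_(jk).  For x = 1 and d = 2 this sum is 1 + r_(e/2), and
-- divisibility of S_2(1) by B^(e/2) - 1 forces 1 + r_(e/2) = N, i.e. B^(e/2) ≡ -1 (mod N).
-- Consequently, for a unit x, the remainders r_(jk) and r_(jk + e/2) are nonzero and add up to N,
-- so for d = 2h the remainders of the block starts sum to hN and S_d(x) = h (B^k - 1).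
module Submission where

open import Defs
open import Data.Nat
open import Data.Nat.Properties
open import Data.Nat.DivMod
open import Data.Nat.Divisibility using (_∣_; divides; ∣-refl; n∣m*n; ∣m⇒∣m*n; m%n≡0⇒n∣m; n∣m⇒m%n≡0)
open import Data.Nat.Coprimality using (Coprime; coprime-divisor; 1-coprimeTo)
open import Data.Product using (_×_; _,_)
open import Relation.Nullary using (¬_; contradiction)
open import Relation.Binary.PropositionalEquality
open import Data.Nat.Tactic.RingSolver using (solve-∀)

open ≡-Reasoning

sumTo-cong : ∀ n {f g : ℕ → ℕ} → (∀ i → i < n → f i ≡ g i) → sumTo n f ≡ sumTo n g
sumTo-cong zero    f≡g = refl
sumTo-cong (suc n) f≡g = cong₂ _+_ (sumTo-cong n (λ i i<n → f≡g i (m<n⇒m<1+n i<n))) (f≡g n ≤-refl)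

*-distribˡ-sumTo : ∀ c n (f : ℕ → ℕ) → c * sumTo n f ≡ sumTo n (λ i → c * f i)
*-distribˡ-sumTo c zero    f = *-zeroʳ c
*-distribˡ-sumTo c (suc n) f = begin
  c * (sumTo n f + f n)          ≡⟨ *-distribˡ-+ c (sumTo n f) (f n) ⟩
  c * sumTo n f + c * f n        ≡⟨ cong (_+ c * f n) (*-distribˡ-sumTo c n f) ⟩
  sumTo n (λ i → c * f i) + c * f n ∎

sumTo-distrib-+ : ∀ n (f g : ℕ → ℕ) → sumTo n (λ i → f i + g i) ≡ sumTo n f + sumTo n g
sumTo-distrib-+ zero    f g = refl
sumTo-distrib-+ (suc n) f g = begin
  sumTo n (λ i → f i + g i) + (f n + g n)   ≡⟨ cong (_+ (f n + g n)) (sumTo-distrib-+ n f g) ⟩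
  sumTo n f + sumTo n g + (f n + g n)       ≡⟨ +-+-comm (sumTo n f) (sumTo n g) (f n) (g n) ⟩
  sumTo n f + f n + (sumTo n g + g n)       ∎
  where
  +-+-comm : ∀ a b c d → a + b + (c + d) ≡ a + c + (b + d)
  +-+-comm = solve-∀

sumTo-const : ∀ n c → sumTo n (λ _ → c) ≡ n * c
sumTo-const zero    c = refl
sumTo-const (suc n) c = trans (cong (_+ c) (sumTo-const n c)) (+-comm (n * c) c)

sumTo-split : ∀ m n (f : ℕ → ℕ) → sumTo (m + n) f ≡ sumTo m f + sumTo n (λ j → f (m + j))
sumTo-split m zero    f = trans (cong (λ l → sumTo l f) (+-identityʳ m)) (sym (+-identityʳ _))
sumTo-split m (suc n) f = begin
  sumTo (m + suc n) f                                  ≡⟨ cong (λ l → sumTo l f) (+-suc m n) ⟩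
  sumTo (m + n) f + f (m + n)                          ≡⟨ cong (_+ f (m + n)) (sumTo-split m n f) ⟩
  sumTo m f + sumTo n (λ j → f (m + j)) + f (m + n)    ≡⟨ +-assoc (sumTo m f) _ _ ⟩
  sumTo m f + (sumTo n (λ j → f (m + j)) + f (m + n))  ∎

sumTo-rotate : ∀ n (f : ℕ → ℕ) → f n ≡ f 0 → sumTo n (λ j → f (suc j)) ≡ sumTo n f
sumTo-rotate n f fn≡f0 = +-cancelˡ-≡ (f 0) _ _ (begin
  f 0 + sumTo n (λ j → f (suc j))  ≡⟨ sym (sumTo-split 1 n f) ⟩
  sumTo n f + f n                  ≡⟨ cong (sumTo n f +_) fn≡f0 ⟩
  sumTo n f + f 0                  ≡⟨ +-comm (sumTo n f) (f 0) ⟩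
  f 0 + sumTo n f                  ∎)

numeral : ℕ → ℕ → (ℕ → ℕ) → ℕ
numeral B k a = sumTo k (λ i → a i * B ^ (k ∸ 1 ∸ i))

m∸n≡suc[m∸1∸n] : ∀ {m n} → n < m → m ∸ n ≡ suc (m ∸ 1 ∸ n)
m∸n≡suc[m∸1∸n] {suc m}       {zero}  _         = refl
m∸n≡suc[m∸1∸n] {suc (suc m)} {suc n} (s<s n<m) = m∸n≡suc[m∸1∸n] n<m

numeral-suc : ∀ B k a → numeral B (suc k) a ≡ B * numeral B k a + a k
numeral-suc B k a = begin
  sumTo k (λ i → a i * B ^ (k ∸ i)) + a k * B ^ (k ∸ k)
    ≡⟨ cong₂ _+_ (sumTo-cong k shift) (cong (λ l → a k * B ^ l) (n∸n≡0 k)) ⟩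
  sumTo k (λ i → B * (a i * B ^ (k ∸ 1 ∸ i))) + a k * 1
    ≡⟨ cong₂ _+_ (sym (*-distribˡ-sumTo B k _)) (*-identityʳ (a k)) ⟩
  B * numeral B k a + a k ∎
  where
  shift : ∀ i → i < k → a i * B ^ (k ∸ i) ≡ B * (a i * B ^ (k ∸ 1 ∸ i))
  shift i i<k = begin
    a i * B ^ (k ∸ i)                ≡⟨ cong (λ l → a i * B ^ l) (m∸n≡suc[m∸1∸n] i<k) ⟩
    a i * (B * B ^ (k ∸ 1 ∸ i))      ≡⟨ *-left-comm (a i) B _ ⟩
    B * (a i * B ^ (k ∸ 1 ∸ i))      ∎
    where
    *-left-comm : ∀ u v w → u * (v * w) ≡ v * (u * w)
    *-left-comm = solve-∀

div′≡/ : ∀ m n .{{_ : NonZero n}} → m div′ n ≡ m / n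
div′≡/ m (suc n) = refl

mod′≡% : ∀ m n .{{_ : NonZero n}} → m mod′ n ≡ m % n
mod′≡% m (suc n) = refl

module _ (B N m : ℕ) .{{_ : NonZero B}} .{{_ : NonZero N}} where

  *-%-rem : B * m % N ≡ B * (m % N) % N
  *-%-rem = begin
    B * m % N                    ≡⟨ %-distribˡ-* B m N ⟩
    B % N * (m % N) % N          ≡⟨ cong (λ r → B % N * r % N) (sym (m%n%n≡m%n m N)) ⟩
    B % N * (m % N % N) % N      ≡⟨ sym (%-distribˡ-* B (m % N) N) ⟩
    B * (m % N) % N              ∎

  *-/-digit : B * m / N % B ≡ B * (m % N) / N
  *-/-digit = begin
    B * m / N % B                              ≡⟨ cong (λ l → l / N % B) B*m≡ ⟩
    (B * (m % N) + m / N * B * N) / N % B       ≡⟨ cong (_% B) (+-distrib-/-∣ʳ _ (n∣m*n (m / N * B))) ⟩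
    (B * (m % N) / N + m / N * B * N / N) % B   ≡⟨ cong (λ l → (B * (m % N) / N + l) % B) (m*n/n≡m _ N) ⟩
    (B * (m % N) / N + m / N * B) % B           ≡⟨ [m+kn]%n≡m%n _ (m / N) B ⟩
    B * (m % N) / N % B                         ≡⟨ m<n⇒m%n≡m (m<n*o⇒m/o<n (*-monoʳ-< B (m%n<n m N))) ⟩
    B * (m % N) / N                             ∎
    where
    B*m≡ : B * m ≡ B * (m % N) + m / N * B * N
    B*m≡ = begin
      B * m                          ≡⟨ cong (B *_) (m≡m%n+[m/n]*n m N) ⟩
      B * (m % N + m / N * N)        ≡⟨ distrib B (m % N) (m / N) N ⟩
      B * (m % N) + m / N * B * N    ∎
      where
      distrib : ∀ b r q n → b * (r + q * n) ≡ b * r + q * b * n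
      distrib = solve-∀

n∣m∧0<m∧m<n+n⇒m≡n : ∀ {m n} → n ∣ m → 0 < m → m < n + n → m ≡ n
n∣m∧0<m∧m<n+n⇒m≡n           (divides zero          refl) ()
n∣m∧0<m∧m<n+n⇒m≡n {n = n} (divides (suc zero)    refl) _ _ = +-identityʳ n
n∣m∧0<m∧m<n+n⇒m≡n {n = n} (divides (suc (suc c)) refl) _ m<n+n =
  contradiction (+-monoʳ-≤ n (m≤m+n n (c * n))) (<⇒≱ m<n+n)

%-complement : ∀ {N} m n .{{_ : NonZero N}} → N ∣ m + n → ¬ N ∣ n → m % N + n % N ≡ N
%-complement {N} m n N∣m+n N∤n = n∣m∧0<m∧m<n+n⇒m≡n N∣sum 0<sum (+-mono-< (m%n<n m N) (m%n<n n N))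
  where
  N∣sum : N ∣ m % N + n % N
  N∣sum = m%n≡0⇒n∣m _ N (trans (sym (%-distribˡ-+ m n N)) (n∣m⇒m%n≡0 (m + n) N N∣m+n))
  0<sum : 0 < m % N + n % N
  0<sum = <-≤-trans (n≢0⇒n>0 (λ n%N≡0 → N∤n (m%n≡0⇒n∣m n N n%N≡0))) (m≤n+m (n % N) (m % N))

module Expansion (B N : ℕ) .{{_ : NonZero B}} .{{_ : NonZero N}} (x : ℕ) where

  rem : ℕ → ℕ
  rem t = B ^ t * x % N

  digit-rem : ∀ t → N * digit B N x (suc t) + rem (suc t) ≡ B * rem t
  digit-rem t = begin
    N * digit B N x (suc t) + rem (suc t)  ≡⟨ cong₂ (λ a r → N * a + r) digit≡ rem≡ ⟩
    N * (B * rem t / N) + B * rem t % N    ≡⟨ +-comm (N * (B * rem t / N)) _ ⟩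
    B * rem t % N + N * (B * rem t / N)    ≡⟨ cong (B * rem t % N +_) (*-comm N _) ⟩
    B * rem t % N + B * rem t / N * N      ≡⟨ sym (m≡m%n+[m/n]*n (B * rem t) N) ⟩
    B * rem t                              ∎
    where
    y : ℕ
    y = B ^ t * x
    digit≡ : digit B N x (suc t) ≡ B * rem t / N
    digit≡ = begin
      ((B * B ^ t * x) div′ N) mod′ B  ≡⟨ mod′≡% _ B ⟩
      (B * B ^ t * x) div′ N % B       ≡⟨ cong (_% B) (div′≡/ _ N) ⟩
      B * B ^ t * x / N % B            ≡⟨ cong (λ l → l / N % B) (*-assoc B (B ^ t) x) ⟩
      B * y / N % B                    ≡⟨ *-/-digit B N y ⟩
      B * rem t / N                    ∎
    rem≡ : rem (suc t) ≡ B * rem t % N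
    rem≡ = trans (cong (_% N) (*-assoc B (B ^ t) x)) (*-%-rem B N y)

  block : ℕ → ℕ → ℕ
  block s k = numeral B k (λ i → digit B N x (s + i + 1))

  block-rem : ∀ s k → N * block s k + rem (s + k) ≡ B ^ k * rem s
  block-rem s zero = begin
    N * 0 + rem (s + 0)  ≡⟨ cong₂ (λ a b → a + rem b) (*-zeroʳ N) (+-identityʳ s) ⟩
    rem s                ≡⟨ sym (*-identityˡ (rem s)) ⟩
    1 * rem s            ∎
  block-rem s (suc k) = begin
    N * block s (suc k) + rem (s + suc k)
      ≡⟨ cong₂ (λ v t → N * v + rem t) (numeral-suc B k (λ i → digit B N x (s + i + 1))) (+-suc s k) ⟩
    N * (B * block s k + digit B N x (s + k + 1)) + rem (suc (s + k))
      ≡⟨ cong (λ t → N * (B * block s k + digit B N x t) + rem (suc (s + k))) (+-comm (s + k) 1) ⟩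
    N * (B * block s k + digit B N x (suc (s + k))) + rem (suc (s + k))
      ≡⟨ regroup N B (block s k) _ _ ⟩
    B * (N * block s k) + (N * digit B N x (suc (s + k)) + rem (suc (s + k)))
      ≡⟨ cong (B * (N * block s k) +_) (digit-rem (s + k)) ⟩
    B * (N * block s k) + B * rem (s + k)
      ≡⟨ sym (*-distribˡ-+ B _ _) ⟩
    B * (N * block s k + rem (s + k))
      ≡⟨ cong (B *_) (block-rem s k) ⟩
    B * (B ^ k * rem s)
      ≡⟨ sym (*-assoc B (B ^ k) (rem s)) ⟩
    B ^ suc k * rem s ∎
    where
    regroup : ∀ n b v a r → n * (b * v + a) + r ≡ b * (n * v) + (n * a + r)
    regroup = solve-∀

  rem-period : ∀ e → N ∣ B ^ e ∸ 1 → rem e ≡ rem 0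
  rem-period e (divides c Bᵉ∸1≡cN) = begin
    B ^ e * x % N          ≡⟨ cong (λ p → p * x % N) Bᵉ≡cN+1 ⟩
    (c * N + 1) * x % N    ≡⟨ cong (_% N) (expand c N x) ⟩
    (x + c * x * N) % N    ≡⟨ [m+kn]%n≡m%n x (c * x) N ⟩
    x % N                  ≡⟨ cong (_% N) (sym (*-identityˡ x)) ⟩
    1 * x % N              ∎
    where
    Bᵉ≡cN+1 : B ^ e ≡ c * N + 1
    Bᵉ≡cN+1 = trans (sym (m∸n+n≡m (m^n>0 B e))) (cong (_+ 1) Bᵉ∸1≡cN)
    expand : ∀ c n x → (c * n + 1) * x ≡ x + c * x * n
    expand = solve-∀

  remSum : ℕ → ℕ → ℕ
  remSum d k = sumTo d (λ j → rem (j * k))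

  N*S+remSum≡Bᵏ*remSum : ∀ d k → rem (d * k) ≡ rem 0 →
                         N * S B N d k x + remSum d k ≡ B ^ k * remSum d k
  N*S+remSum≡Bᵏ*remSum d k periodic = begin
    N * S B N d k x + remSum d k
      ≡⟨ cong₂ _+_ (*-distribˡ-sumTo N d _) (sym (sumTo-rotate d (λ j → rem (j * k)) periodic)) ⟩
    sumTo d (λ j → N * block (j * k) k) + sumTo d (λ j → rem (k + j * k))
      ≡⟨ sym (sumTo-distrib-+ d _ _) ⟩
    sumTo d (λ j → N * block (j * k) k + rem (k + j * k))
      ≡⟨ sumTo-cong d (λ j _ → trans (cong (λ t → N * block (j * k) k + rem t) (+-comm k (j * k)))
                                      (block-rem (j * k) k)) ⟩
    sumTo d (λ j → B ^ k * rem (j * k))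
      ≡⟨ sym (*-distribˡ-sumTo (B ^ k) d _) ⟩
    B ^ k * remSum d k ∎

  N*S≡[Bᵏ∸1]*remSum : ∀ d k → N ∣ B ^ (k * d) ∸ 1 → N * S B N d k x ≡ (B ^ k ∸ 1) * remSum d k
  N*S≡[Bᵏ∸1]*remSum d k N∣Bᵏᵈ∸1 = begin
    N * S B N d k x                       ≡⟨ sym (m+n∸n≡m _ (remSum d k)) ⟩
    N * S B N d k x + remSum d k ∸ remSum d k
      ≡⟨ cong (_∸ remSum d k) (N*S+remSum≡Bᵏ*remSum d k periodic) ⟩
    B ^ k * remSum d k ∸ remSum d k       ≡⟨ cong (B ^ k * remSum d k ∸_) (sym (*-identityˡ (remSum d k))) ⟩
    B ^ k * remSum d k ∸ 1 * remSum d k   ≡⟨ sym (*-distribʳ-∸ (remSum d k) (B ^ k) 1) ⟩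
    (B ^ k ∸ 1) * remSum d k              ∎
    where
    periodic : rem (d * k) ≡ rem 0
    periodic = rem-period (d * k) (subst (λ e → N ∣ B ^ e ∸ 1) (*-comm k d) N∣Bᵏᵈ∸1)

  remSum-antipodal : ∀ h k → N ∣ B ^ (h * k) + 1 → (∀ t → ¬ N ∣ B ^ t * x) → remSum (2 * h) k ≡ h * N
  remSum-antipodal h k N∣Bʰᵏ+1 N∤ = begin
    sumTo (h + (h + 0)) f                    ≡⟨ cong (λ l → sumTo (h + l) f) (+-identityʳ h) ⟩
    sumTo (h + h) f                          ≡⟨ sumTo-split h h f ⟩
    sumTo h f + sumTo h (λ j → f (h + j))    ≡⟨ sym (sumTo-distrib-+ h f _) ⟩
    sumTo h (λ j → f j + f (h + j))          ≡⟨ sumTo-cong h (λ j _ → antipodal j) ⟩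
    sumTo h (λ _ → N)                        ≡⟨ sumTo-const h N ⟩
    h * N                                    ∎
    where
    f : ℕ → ℕ
    f j = rem (j * k)
    antipodal : ∀ j → f j + f (h + j) ≡ N
    antipodal j = begin
      z % N + B ^ ((h + j) * k) * x % N  ≡⟨ +-comm (z % N) _ ⟩
      B ^ ((h + j) * k) * x % N + z % N  ≡⟨ cong (λ p → p % N + z % N) shift ⟩
      B ^ (h * k) * z % N + z % N        ≡⟨ %-complement _ z N∣sum (N∤ (j * k)) ⟩
      N                                  ∎
      where
      z : ℕ
      z = B ^ (j * k) * x
      shift : B ^ ((h + j) * k) * x ≡ B ^ (h * k) * z
      shift = begin
        B ^ ((h + j) * k) * x           ≡⟨ cong (λ e → B ^ e * x) (*-distribʳ-+ k h j) ⟩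
        B ^ (h * k + j * k) * x         ≡⟨ cong (_* x) (^-distribˡ-+-* B (h * k) (j * k)) ⟩
        B ^ (h * k) * B ^ (j * k) * x   ≡⟨ *-assoc (B ^ (h * k)) _ x ⟩
        B ^ (h * k) * z                 ∎
      N∣sum : N ∣ B ^ (h * k) * z + z
      N∣sum = subst (N ∣_) (trans (*-distribʳ-+ z (B ^ (h * k)) 1) (cong (B ^ (h * k) * z +_) (*-identityˡ z)))
                    (∣m⇒∣m*n z N∣Bʰᵏ+1)

  S≡h*[Bᵏ∸1] : ∀ h k → N ∣ B ^ (k * (2 * h)) ∸ 1 → N ∣ B ^ (h * k) + 1 → (∀ t → ¬ N ∣ B ^ t * x) →
               S B N (2 * h) k x ≡ h * (B ^ k ∸ 1)
  S≡h*[Bᵏ∸1] h k N∣Bᵉ∸1 N∣Bʰᵏ+1 N∤ = *-cancelˡ-≡ _ _ N (begin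
    N * S B N (2 * h) k x              ≡⟨ N*S≡[Bᵏ∸1]*remSum (2 * h) k N∣Bᵉ∸1 ⟩
    (B ^ k ∸ 1) * remSum (2 * h) k     ≡⟨ cong ((B ^ k ∸ 1) *_) (remSum-antipodal h k N∣Bʰᵏ+1 N∤) ⟩
    (B ^ k ∸ 1) * (h * N)              ≡⟨ rearrange (B ^ k ∸ 1) h N ⟩
    N * (h * (B ^ k ∸ 1))              ∎)
    where
    rearrange : ∀ p h n → p * (h * n) ≡ n * (h * p)
    rearrange = solve-∀

∤B^t*x : ∀ {B N x} → 1 < N → Coprime N B → Coprime x N → ∀ t → ¬ N ∣ B ^ t * x
∤B^t*x {N = N} {x} 1<N N⊥B x⊥N zero    N∣1*x =
  <⇒≢ 1<N (sym (x⊥N (subst (N ∣_) (*-identityˡ x) N∣1*x , ∣-refl)))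
∤B^t*x {B} {N} {x} 1<N N⊥B x⊥N (suc t) N∣B*Bᵗ*x =
  ∤B^t*x 1<N N⊥B x⊥N t (coprime-divisor N⊥B (subst (N ∣_) (*-assoc B (B ^ t) x) N∣B*Bᵗ*x))

M₂⇒N∣Bᵏ+1 : ∀ {B N k} .{{_ : NonZero B}} .{{_ : NonZero N}} → 1 < B → 1 < N → 0 < k →
            N ∣ B ^ (k * 2) ∸ 1 → (B ^ k ∸ 1) ∣ S B N 2 k 1 → N ∣ B ^ k + 1
M₂⇒N∣Bᵏ+1 {B} {N} {k} 1<B 1<N 0<k N∣B²ᵏ∸1 (divides c S≡cP) = m%n≡0⇒n∣m _ N (begin
  (B ^ k + 1) % N      ≡⟨ cong (λ p → (p + 1) % N) (sym (*-identityʳ (B ^ k))) ⟩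
  (B ^ k * 1 + 1) % N  ≡⟨ %-distribˡ-+ (B ^ k * 1) 1 N ⟩
  (rem k + rem 0) % N  ≡⟨ cong (_% N) (trans (+-comm (rem k) (rem 0)) rem0+remk≡N) ⟩
  N % N                ≡⟨ n%n≡0 N ⟩
  0                    ∎)
  where
  open Expansion B N 1
  P : ℕ
  P = B ^ k ∸ 1
  instance
    P≢0 : NonZero P
    P≢0 = >-nonZero (m<n⇒0<n∸m (^-monoʳ-< B 1<B 0<k))
  remSum≡ : remSum 2 k ≡ rem 0 + rem k
  remSum≡ = cong (λ t → rem 0 + rem t) (+-identityʳ k)
  N*c≡remSum : N * c ≡ remSum 2 k
  N*c≡remSum = *-cancelʳ-≡ _ _ P (begin
    N * c * P          ≡⟨ *-assoc N c P ⟩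
    N * (c * P)        ≡⟨ cong (N *_) (sym S≡cP) ⟩
    N * S B N 2 k 1    ≡⟨ N*S≡[Bᵏ∸1]*remSum 2 k N∣B²ᵏ∸1 ⟩
    P * remSum 2 k     ≡⟨ *-comm P _ ⟩
    remSum 2 k * P     ∎)
  rem0+remk≡N : rem 0 + rem k ≡ N
  rem0+remk≡N = n∣m∧0<m∧m<n+n⇒m≡n
    (divides c (trans (sym remSum≡) (trans (sym N*c≡remSum) (*-comm N c))))
    (<-≤-trans (subst (0 <_) (sym (m<n⇒m%n≡m 1<N)) z<s) (m≤m+n (rem 0) (rem k)))
    (+-mono-< (m%n<n 1 N) (m%n<n _ N))

theorem6 : (B N e : ℕ) → 1 < B → 1 < N → Coprime N B → IsOrd B N e →
           InM 2 B N e →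
           (h k : ℕ) → e ≡ k * (2 * h) →
           InM (2 * h) B N e
             × ((x : ℕ) → Unit N x → S B N (2 * h) k x ≡ h * (B ^ k ∸ 1))
theorem6 B N e 1<B 1<N N⊥B ((0<e , N∣Bᵉ∸1) , _) (k₂ , e≡k₂*2 , M₂) h k e≡k*2h =
  (k , e≡k*2h , λ x x-unit → divides h (S-value x x-unit)) , S-value
  where
  instance
    B≢0 : NonZero B
    B≢0 = nonTrivial⇒nonZero B {{n>1⇒nonTrivial 1<B}}
    N≢0 : NonZero N
    N≢0 = nonTrivial⇒nonZero N {{n>1⇒nonTrivial 1<N}}
  k₂≡h*k : k₂ ≡ h * k
  k₂≡h*k = *-cancelʳ-≡ k₂ (h * k) 2 (trans (sym e≡k₂*2) (trans e≡k*2h (rearrange k h)))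
    where
    rearrange : ∀ k h → k * (2 * h) ≡ h * k * 2
    rearrange = solve-∀
  0<k₂ : 0 < k₂
  0<k₂ = n≢0⇒n>0 (λ k₂≡0 → <⇒≢ 0<e (sym (trans e≡k₂*2 (cong (_* 2) k₂≡0))))
  N∣Bʰᵏ+1 : N ∣ B ^ (h * k) + 1
  N∣Bʰᵏ+1 = subst (λ l → N ∣ B ^ l + 1) k₂≡h*k
    (M₂⇒N∣Bᵏ+1 1<B 1<N 0<k₂ (subst (λ l → N ∣ B ^ l ∸ 1) e≡k₂*2 N∣Bᵉ∸1)
               (M₂ 1 (≤-refl , 1<N , 1-coprimeTo N)))
  S-value : (x : ℕ) → Unit N x → S B N (2 * h) k x ≡ h * (B ^ k ∸ 1)
  S-value x (_ , _ , x⊥N) = Expansion.S≡h*[Bᵏ∸1] B N x h k (subst (λ l → N ∣ B ^ l ∸ 1) e≡k*2h N∣Bᵉ∸1)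
                              N∣Bʰᵏ+1 (∤B^t*x 1<N N⊥B x⊥N)
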